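{- Let $N$ be a positive integer. Any congruence subgroup $\Gamma$ of $\mathrm{SL}_2(\mathbb{Z})$ that contains $\begin{pmatrix}1&1\\0&1\end{pmatrix}$ and $\begin{pmatrix}1&0\\N&1\end{pmatrix}$ contains $\Gamma_1(N)$.
   Context: A congruence subgroup is a subgroup of $\mathrm{SL}_2(\mathbb{Z})$ containing $\Gamma(M)=\{\gamma\in\mathrm{SL}_2(\mathbb{Z}):\gamma\equiv I\pmod M\}$ for some $M\ge1$. $\Gamma_1(N)$ is the set of $\begin{pmatrix}a&b\\c&d\end{pmatrix}\in\mathrm{SL}_2(\mathbb{Z})$ with $c\equiv0$ and $a\equiv d\equiv1\pmod N$. -}

module Defs where

open import Data.Nat using (ℕ) renaming (_≥_ to _≥ℕ_)
open import Data.Integer using (ℤ; +_; _+_; _-_; _*_; -_; 0ℤ; 1ℤ)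
open import Data.Integer.Divisibility using (_∣_)
open import Data.Product using (_×_; ∃-syntax)
open import Relation.Binary.PropositionalEquality using (_≡_)

record Mat : Set where
  constructor mat
  field
    a b c d : ℤ
open Mat public

det : Mat → ℤ
det (mat a b c d) = a * d - b * c

SL₂ℤ : Mat → Set
SL₂ℤ A = det A ≡ 1ℤ

_·_ : Mat → Mat → Mat
mat a b c d · mat a' b' c' d' =
  mat (a * a' + b * c') (a * b' + b * d') (c * a' + d * c') (c * b' + d * d')

-- inverse of a determinant-one matrix (the adjugate)
inv : Mat → Mat
inv (mat a b c d) = mat d (- b) (- c) a

I : Mat
I = mat 1ℤ 0ℤ 0ℤ 1ℤ

T : Mat
T = mat 1ℤ 1ℤ 0ℤ 1ℤ

L : ℕ → Mat
L N = mat 1ℤ 0ℤ (+ N) 1ℤ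

_≡_[mod_] : ℤ → ℤ → ℕ → Set
x ≡ y [mod M ] = (+ M) ∣ (x - y)

record IsSubgroupSL₂ (Γ : Mat → Set) : Set where
  field
    ⊆SL₂ : ∀ A → Γ A → SL₂ℤ A
    has-I : Γ I
    ·-closed : ∀ A B → Γ A → Γ B → Γ (A · B)
    inv-closed : ∀ A → Γ A → Γ (inv A)

Γ[_] : ℕ → Mat → Set
Γ[ M ] A = SL₂ℤ A × (a A ≡ 1ℤ [mod M ]) × (b A ≡ 0ℤ [mod M ])
                  × (c A ≡ 0ℤ [mod M ]) × (d A ≡ 1ℤ [mod M ])

Γ₁ : ℕ → Mat → Set
Γ₁ N A = SL₂ℤ A × (c A ≡ 0ℤ [mod N ]) × (a A ≡ 1ℤ [mod N ]) × (d A ≡ 1ℤ [mod N ])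

_⊆_ : (Mat → Set) → (Mat → Set) → Set
P ⊆ Q = ∀ A → P A → Q A

IsCongruenceSubgroup : (Mat → Set) → Set
IsCongruenceSubgroup Γ = IsSubgroupSL₂ Γ × ∃[ M ] (M ≥ℕ 1 × Γ[ M ] ⊆ Γ)

module Submission where

-- Left multiplication by T^k and by L^j = (1 0 ; jN 1) performs the row operations
-- a ↦ a + k c and c ↦ c + jN a on the first column (a , c) of a matrix.  For A in Γ₁(N)
-- write a = 1 + τN and c = c₀N, and let m be the level of Γ.  Since c₀ and a are coprime,
-- some w = c₀ + j a is coprime to m: split m = m′ r with m′ coprime to c₀ and every prime
-- factor of r dividing c₀, and take j = m′.  After L^j the column is (a , N w) with w
-- invertible mod m, say w w⁻¹ ≡ 1; then T^(-τ w⁻¹) makes a ≡ 1 and L^(-w) makes c ≡ 0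
-- (mod m).  Finally a matrix of SL₂(ℤ) with first column ≡ (1 , 0) (mod m) lies in
-- T^ℤ Γ(m) ⊆ Γ.

open import Defs
open import Data.Nat as ℕ using (ℕ; zero; suc; NonZero; _<_; _≥_; >-nonZero; ≢-nonZero⁻¹)
open import Data.Nat.Coprimality using (Coprime; coprime?; coprime-Bézout; gcd≡1⇒coprime)
open import Data.Nat.Divisibility as ℕ using (divides)
open import Data.Nat.GCD using (gcd; gcd[m,n]∣m; gcd[m,n]∣n; gcd[m,n]≡0⇒m≡0; module Bézout)
open import Data.Nat.Induction using (<-wellFounded)
open import Data.Nat.Properties using (m<m*n)
open import Data.Integer using (ℤ; +_; -[1+_]; _+_; _-_; _*_; -_; 0ℤ; 1ℤ; -1ℤ; ∣_∣)
open import Data.Integer.Divisibility.Signed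
  using (divides; ∣ᵤ⇒∣; ∣⇒∣ᵤ; ∣m∣n⇒∣m-n; ∣n⇒∣m*n; ∣m⇒∣m*n)
  renaming (_∣_ to _∣ℤ_)
open import Data.Integer.Properties
  using (pos-*; *-assoc; *-identityˡ; *-identityʳ; *-distribʳ-+; neg-distribˡ-*)
open import Data.Integer.Tactic.RingSolver using (solve-∀)
open import Data.Product using (∃-syntax; ∃₂; _×_; _,_)
open import Induction.WellFounded using (Acc; acc)
open import Data.Empty using (⊥-elim)
open import Relation.Nullary using (¬_; yes; no; contradiction)
open import Relation.Binary.PropositionalEquality
  using (_≡_; refl; sym; trans; cong; cong₂; subst; module ≡-Reasoning)

-- Coprimality in Bézout form: its witnesses are what the matrix reduction consumes.
Unimodular : ℤ → ℤ → Set
Unimodular x y = ∃₂ λ u v → u * x + v * y ≡ 1ℤ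

unimodular-sym : ∀ {x y} → Unimodular x y → Unimodular y x
unimodular-sym {x} {y} (u , v , ux+vy≡1) = v , u , trans (identity u x v y) ux+vy≡1
  where
  identity : ∀ u x v y → v * y + u * x ≡ u * x + v * y
  identity = solve-∀

unimodular-1 : ∀ x → Unimodular x 1ℤ
unimodular-1 x = 0ℤ , 1ℤ , identity x
  where
  identity : ∀ x → 0ℤ * x + 1ℤ * 1ℤ ≡ 1ℤ
  identity = solve-∀

unimodular-neg : ∀ {x y} → Unimodular x y → Unimodular x (- y)
unimodular-neg {x} {y} (u , v , ux+vy≡1) = u , - v , trans (identity u x v y) ux+vy≡1
  where
  identity : ∀ u x v y → u * x + - v * - y ≡ u * x + v * y
  identity = solve-∀

unimodular-*ʳ : ∀ {x y z} → Unimodular x y → Unimodular x z → Unimodular x (y * z)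
unimodular-*ʳ {x} {y} {z} (u , v , ux+vy≡1) (u′ , v′ , u′x+v′z≡1) =
  u * u′ * x + u * v′ * z + v * y * u′ , v * v′ ,
  trans (identity x y z u v u′ v′) (cong₂ _*_ ux+vy≡1 u′x+v′z≡1)
  where
  identity : ∀ x y z u v u′ v′ → (u * u′ * x + u * v′ * z + v * y * u′) * x + v * v′ * (y * z)
                                 ≡ (u * x + v * y) * (u′ * x + v′ * z)
  identity = solve-∀

unimodular-+* : ∀ {x y} → Unimodular x y → ∀ k → Unimodular (x + y * k) y
unimodular-+* {x} {y} (u , v , ux+vy≡1) k = u , v - u * k , trans (identity x y k u v) ux+vy≡1
  where
  identity : ∀ x y k u v → u * (x + y * k) + (v - u * k) * y ≡ u * x + v * y
  identity = solve-∀

unimodular-+ : ∀ {x y} → Unimodular x y → Unimodular (x + y) x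
unimodular-+ {x} {y} (u , v , ux+vy≡1) = v , u - v , trans (identity x y u v) ux+vy≡1
  where
  identity : ∀ x y u v → v * (x + y) + (u - v) * x ≡ u * x + v * y
  identity = solve-∀

unimodular-∣ : ∀ {x y z} → Unimodular x y → z ∣ℤ y → Unimodular x z
unimodular-∣ {x} (u , v , ux+vy≡1) (divides q refl) =
  u , v * q , trans (identity x q _ u v) ux+vy≡1
  where
  identity : ∀ x q z u v → u * x + v * q * z ≡ u * x + v * (q * z)
  identity = solve-∀

cast-1+* : ∀ a b c d → 1 ℕ.+ a ℕ.* b ≡ c ℕ.* d → 1ℤ + + a * + b ≡ + c * + d
cast-1+* a b c d eq =
  trans (cong (λ t → 1ℤ + t) (sym (pos-* a b))) (trans (cong +_ eq) (pos-* c d))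

bézout⇒unimodular : ∀ {m n} → Bézout.Identity 1 m n → Unimodular (+ m) (+ n)
bézout⇒unimodular {m} {n} (Bézout.+- u v 1+vn≡um) =
  + u , - + v ,
  trans (cong (_+ - + v * + n) (sym (cast-1+* v n u m 1+vn≡um))) (identity (+ v) (+ n))
  where
  identity : ∀ v n → 1ℤ + v * n + - v * n ≡ 1ℤ
  identity = solve-∀
bézout⇒unimodular {m} {n} (Bézout.-+ u v 1+um≡vn) =
  - + u , + v ,
  trans (cong (λ t → - + u * + m + t) (sym (cast-1+* u m v n 1+um≡vn))) (identity (+ u) (+ m))
  where
  identity : ∀ u m → - u * m + (1ℤ + u * m) ≡ 1ℤ
  identity = solve-∀

coprime⇒unimodular : ∀ {m} x → Coprime m ∣ x ∣ → Unimodular (+ m) x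
coprime⇒unimodular (+ n)    m⊥n = bézout⇒unimodular (coprime-Bézout m⊥n)
coprime⇒unimodular -[1+ n ] m⊥n = unimodular-neg (bézout⇒unimodular (coprime-Bézout m⊥n))

nontrivial-common-divisor : ∀ m n .{{_ : NonZero m}} → ¬ Coprime m n →
                            ∃[ g ] 1 < g × g ℕ.∣ m × g ℕ.∣ n
nontrivial-common-divisor m n ¬m⊥n with gcd m n in gcd≡g
... | 0           = contradiction (gcd[m,n]≡0⇒m≡0 gcd≡g) (≢-nonZero⁻¹ m)
... | 1           = ⊥-elim (¬m⊥n (gcd≡1⇒coprime gcd≡g))
... | suc (suc k) = suc (suc k) , ℕ.s<s ℕ.z<s
                  , subst (ℕ._∣ m) gcd≡g (gcd[m,n]∣m m n) , subst (ℕ._∣ n) gcd≡g (gcd[m,n]∣n m n)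

CoprimeFactorisation : ℤ → ℕ → Set
CoprimeFactorisation x m =
  ∃₂ λ m′ r → + m ≡ m′ * r × Unimodular m′ x × (∀ {z} → Unimodular z x → Unimodular z r)

coprime-factorisation : ∀ x m .{{_ : NonZero m}} → CoprimeFactorisation x m
coprime-factorisation x m = go (<-wellFounded m)
  where
  go : ∀ {m} → Acc _<_ m → .{{_ : NonZero m}} → CoprimeFactorisation x m
  go {m} (acc smaller) with coprime? m ∣ x ∣
  ... | yes m⊥x = + m , 1ℤ , sym (*-identityʳ (+ m)) , coprime⇒unimodular x m⊥x , λ _ → unimodular-1 _
  ... | no ¬m⊥x with nontrivial-common-divisor m ∣ x ∣ ¬m⊥x
  ...   | g , 1<g , divides zero m≡0 , _ = contradiction m≡0 (≢-nonZero⁻¹ m)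
  ...   | g , 1<g , divides q@(suc _) m≡qg , g∣x
    with go (smaller (subst (q <_) (sym m≡qg) (m<m*n q g 1<g)))
  ...     | m′ , r , q≡m′r , m′⊥x , coprime-to-r =
    m′ , r * + g , m≡m′rg , m′⊥x ,
    λ z⊥x → unimodular-*ʳ (coprime-to-r z⊥x) (unimodular-∣ z⊥x (∣ᵤ⇒∣ g∣x))
    where
    open ≡-Reasoning
    m≡m′rg : + m ≡ m′ * (r * + g)
    m≡m′rg = begin
      + m             ≡⟨ cong +_ m≡qg ⟩
      + (q ℕ.* g)     ≡⟨ pos-* q g ⟩
      + q * + g       ≡⟨ cong (_* + g) q≡m′r ⟩
      m′ * r * + g    ≡⟨ *-assoc m′ r (+ g) ⟩
      m′ * (r * + g)  ∎

unimodular-translate : ∀ m .{{_ : NonZero m}} {x y} → Unimodular x y →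
                       ∃[ j ] Unimodular (x + j * y) (+ m)
unimodular-translate m {x} {y} x⊥y with coprime-factorisation x m
... | m′ , r , m≡m′r , m′⊥x , coprime-to-r =
  m′ , subst (Unimodular (x + m′ * y)) (sym m≡m′r) (unimodular-*ʳ x′⊥m′ x′⊥r)
  where
  x′⊥m′ : Unimodular (x + m′ * y) m′
  x′⊥m′ = unimodular-+* (unimodular-sym m′⊥x) y
  x′⊥r : Unimodular (x + m′ * y) r
  x′⊥r = coprime-to-r (unimodular-+ (unimodular-*ʳ (unimodular-sym m′⊥x) x⊥y))

bézout⇒∣1-* : ∀ u x v y → u * x + v * y ≡ 1ℤ → y ∣ℤ 1ℤ - u * x
bézout⇒∣1-* u x v y ux+vy≡1 =
  divides v (trans (cong (_- u * x) (sym ux+vy≡1)) (identity u x v y))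
  where
  identity : ∀ u x v y → u * x + v * y - u * x ≡ v * y
  identity = solve-∀

mod-witness : ∀ x y {M} → x ≡ y [mod M ] → ∃[ k ] x ≡ y + k * + M
mod-witness x y x≡y with ∣ᵤ⇒∣ x≡y
... | divides k x-y≡kM = k , trans (identity x y) (cong (λ t → y + t) x-y≡kM)
  where
  identity : ∀ x y → x ≡ y + (x - y)
  identity = solve-∀

mat-≡ : ∀ {a b c d a′ b′ c′ d′} → a ≡ a′ → b ≡ b′ → c ≡ c′ → d ≡ d′ →
        mat a b c d ≡ mat a′ b′ c′ d′
mat-≡ refl refl refl refl = refl

E₁₂ : ℤ → Mat
E₁₂ x = mat 1ℤ x 0ℤ 1ℤ

E₂₁ : ℤ → Mat
E₂₁ x = mat 1ℤ 0ℤ x 1ℤ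

E₁₂-+ : ∀ x y → E₁₂ x · E₁₂ y ≡ E₁₂ (x + y)
E₁₂-+ x y = mat-≡ (a-entry x) (b-entry x y) refl (d-entry y)
  where
  a-entry : ∀ x → 1ℤ * 1ℤ + x * 0ℤ ≡ 1ℤ
  a-entry = solve-∀
  b-entry : ∀ x y → 1ℤ * y + x * 1ℤ ≡ x + y
  b-entry = solve-∀
  d-entry : ∀ y → 0ℤ * y + 1ℤ * 1ℤ ≡ 1ℤ
  d-entry = solve-∀

E₂₁-+ : ∀ x y → E₂₁ x · E₂₁ y ≡ E₂₁ (x + y)
E₂₁-+ x y = mat-≡ (a-entry y) refl (c-entry x y) (d-entry x)
  where
  a-entry : ∀ y → 1ℤ * 1ℤ + 0ℤ * y ≡ 1ℤ
  a-entry = solve-∀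
  c-entry : ∀ x y → x * 1ℤ + 1ℤ * y ≡ x + y
  c-entry = solve-∀
  d-entry : ∀ x → x * 0ℤ + 1ℤ * 1ℤ ≡ 1ℤ
  d-entry = solve-∀

E₁₂-·-undo : ∀ k a b c d → E₁₂ (- k) · mat (a + k * c) (b + k * d) c d ≡ mat a b c d
E₁₂-·-undo k a b c d = mat-≡ (row₁ k a c) (row₁ k b d) (row₂ a c) (row₂ b d)
  where
  row₁ : ∀ k x y → 1ℤ * (x + k * y) + - k * y ≡ x
  row₁ = solve-∀
  row₂ : ∀ x y → 0ℤ * x + 1ℤ * y ≡ y
  row₂ = solve-∀

E₂₁-·-undo : ∀ k a b c d → E₂₁ (- k) · mat a b (c + k * a) (d + k * b) ≡ mat a b c d
E₂₁-·-undo k a b c d = mat-≡ (row₁ a c) (row₁ b d) (row₂ k a c) (row₂ k b d)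
  where
  row₁ : ∀ x y → 1ℤ * x + 0ℤ * y ≡ x
  row₁ = solve-∀
  row₂ : ∀ k x y → - k * x + 1ℤ * (y + k * x) ≡ y
  row₂ = solve-∀

det-addRow₁ : ∀ k a b c d → det (mat (a + k * c) (b + k * d) c d) ≡ det (mat a b c d)
det-addRow₁ = identity
  where
  identity : ∀ k a b c d → (a + k * c) * d - (b + k * d) * c ≡ a * d - b * c
  identity = solve-∀

det-addRow₂ : ∀ k a b c d → det (mat a b (c + k * a) (d + k * b)) ≡ det (mat a b c d)
det-addRow₂ = identity
  where
  identity : ∀ k a b c d → a * (d + k * b) - b * (c + k * a) ≡ a * d - b * c
  identity = solve-∀

module _ {Γ : Mat → Set} (Γ-subgroup : IsSubgroupSL₂ Γ) where
  open IsSubgroupSL₂ Γ-subgroup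

  Γ-∋-one-parameter : (P : ℤ → Mat) → (∀ x y → P x · P y ≡ P (x + y)) →
                      (∀ x → inv (P x) ≡ P (- x)) → Γ (P 1ℤ) → ∀ k → Γ (P k)
  Γ-∋-one-parameter P P-+ P-inv ΓP₁ = Γ-P
    where
    Γ-P₊ : ∀ n → Γ (P (+ n))
    Γ-P₊ zero    = subst Γ (trans (cong (P 1ℤ ·_) (P-inv 1ℤ)) (P-+ 1ℤ -1ℤ))
                         (·-closed _ _ ΓP₁ (inv-closed _ ΓP₁))
    Γ-P₊ (suc n) = subst Γ (P-+ 1ℤ (+ n)) (·-closed _ _ ΓP₁ (Γ-P₊ n))

    Γ-P : ∀ k → Γ (P k)
    Γ-P (+ n)    = Γ-P₊ n
    Γ-P -[1+ n ] = subst Γ (P-inv (+ suc n)) (inv-closed _ (Γ-P₊ (suc n)))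

  Γ-addRow₁ : ∀ {k a b c d} → Γ (E₁₂ k) → Γ (mat (a + k * c) (b + k * d) c d) → Γ (mat a b c d)
  Γ-addRow₁ {k} {a} {b} {c} {d} ΓE h =
    subst Γ (E₁₂-·-undo k a b c d) (·-closed _ _ (inv-closed _ ΓE) h)

  Γ-addRow₂ : ∀ {k a b c d} → Γ (E₂₁ k) → Γ (mat a b (c + k * a) (d + k * b)) → Γ (mat a b c d)
  Γ-addRow₂ {k} {a} {b} {c} {d} ΓE h =
    subst Γ (E₂₁-·-undo k a b c d) (·-closed _ _ (inv-closed _ ΓE) h)

module Reduction (N : ℕ) {Γ : Mat → Set} (Γ-subgroup : IsSubgroupSL₂ Γ) (ΓT : Γ T) (ΓL : Γ (L N))
                 (m : ℕ) .{{_ : NonZero m}} (Γ[m]⊆Γ : Γ[ m ] ⊆ Γ) where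

  n : ℤ
  n = + N

  Γ-E₁₂ : ∀ k → Γ (E₁₂ k)
  Γ-E₁₂ = Γ-∋-one-parameter Γ-subgroup E₁₂ E₁₂-+ (λ _ → refl) ΓT

  Γ-E₂₁-N : ∀ j → Γ (E₂₁ (j * n))
  Γ-E₂₁-N = Γ-∋-one-parameter Γ-subgroup (λ j → E₂₁ (j * n))
    (λ x y → trans (E₂₁-+ (x * n) (y * n)) (cong E₂₁ (sym (*-distribʳ-+ n x y))))
    (λ x → cong E₂₁ (neg-distribˡ-* x n))
    (subst Γ (cong E₂₁ (sym (*-identityˡ n))) ΓL)

  Γ-of-first-column≡e₁ : ∀ {a b c d} → det (mat a b c d) ≡ 1ℤ →
                         a ≡ 1ℤ [mod m ] → c ≡ 0ℤ [mod m ] → Γ (mat a b c d)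
  Γ-of-first-column≡e₁ {a} {b} {c} {d} det≡1 a≡1 c≡0 =
    Γ-addRow₁ Γ-subgroup (Γ-E₁₂ (- b)) (Γ[m]⊆Γ _
      (trans (det-addRow₁ (- b) a b c d) det≡1 , ∣⇒∣ᵤ m∣a′-1 , ∣⇒∣ᵤ m∣b′ , c≡0 , ∣⇒∣ᵤ m∣d-1))
    where
    m∣a-1 : + m ∣ℤ a - 1ℤ
    m∣a-1 = ∣ᵤ⇒∣ a≡1
    m∣c : + m ∣ℤ c - 0ℤ
    m∣c = ∣ᵤ⇒∣ c≡0
    d-1≡ : ∀ a b c d → d - (a * d - b * c) ≡ b * (c - 0ℤ) - (a - 1ℤ) * d
    d-1≡ = solve-∀
    m∣d-1 : + m ∣ℤ d - 1ℤ
    m∣d-1 = subst (+ m ∣ℤ_) (trans (sym (d-1≡ a b c d)) (cong (λ t → d - t) det≡1))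
                  (∣m∣n⇒∣m-n (∣n⇒∣m*n b m∣c) (∣m⇒∣m*n d m∣a-1))
    a′-1≡ : ∀ a b c → a + - b * c - 1ℤ ≡ (a - 1ℤ) - b * (c - 0ℤ)
    a′-1≡ = solve-∀
    m∣a′-1 : + m ∣ℤ a + - b * c - 1ℤ
    m∣a′-1 = subst (+ m ∣ℤ_) (sym (a′-1≡ a b c)) (∣m∣n⇒∣m-n m∣a-1 (∣n⇒∣m*n b m∣c))
    b′≡ : ∀ b d → b + - b * d - 0ℤ ≡ - b * (d - 1ℤ)
    b′≡ = solve-∀
    m∣b′ : + m ∣ℤ b + - b * d - 0ℤ
    m∣b′ = subst (+ m ∣ℤ_) (sym (b′≡ b d)) (∣n⇒∣m*n (- b) m∣d-1)

  Γ-of-first-column-N·unit : ∀ τ {b c d w} → c ≡ n * w → Unimodular w (+ m) →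
                             det (mat (1ℤ + τ * n) b c d) ≡ 1ℤ → Γ (mat (1ℤ + τ * n) b c d)
  Γ-of-first-column-N·unit τ {b} {_} {d} {w} refl (w⁻¹ , v , bézout) det≡1 =
    Γ-addRow₁ Γ-subgroup (Γ-E₁₂ k) (Γ-addRow₂ Γ-subgroup (Γ-E₂₁-N (- w))
      (Γ-of-first-column≡e₁ det′≡1 (∣⇒∣ᵤ m∣a′-1) (∣⇒∣ᵤ m∣c′)))
    where
    k : ℤ
    k = - (τ * w⁻¹)
    a′ b′ : ℤ
    a′ = 1ℤ + τ * n + k * (n * w)
    b′ = b + k * d
    det′≡1 : det (mat a′ b′ (n * w + - w * n * a′) (d + - w * n * b′)) ≡ 1ℤ
    det′≡1 = trans (det-addRow₂ (- w * n) a′ b′ (n * w) d)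
                   (trans (det-addRow₁ k (1ℤ + τ * n) b (n * w) d) det≡1)
    a′-1≡ : ∀ τ n w w⁻¹ → 1ℤ + τ * n + - (τ * w⁻¹) * (n * w) - 1ℤ ≡ τ * n * (1ℤ - w⁻¹ * w)
    a′-1≡ = solve-∀
    m∣a′-1 : + m ∣ℤ a′ - 1ℤ
    m∣a′-1 = subst (+ m ∣ℤ_) (sym (a′-1≡ τ n w w⁻¹))
                   (∣n⇒∣m*n (τ * n) (bézout⇒∣1-* w⁻¹ w v (+ m) bézout))
    c′≡ : ∀ n w a′ → n * w + - w * n * a′ - 0ℤ ≡ - w * n * (a′ - 1ℤ)
    c′≡ = solve-∀
    m∣c′ : + m ∣ℤ n * w + - w * n * a′ - 0ℤ
    m∣c′ = subst (+ m ∣ℤ_) (sym (c′≡ n w a′)) (∣n⇒∣m*n (- w * n) m∣a′-1)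

  Γ-of-Γ₁-form : ∀ τ c₀ b d → det (mat (1ℤ + τ * n) b (0ℤ + c₀ * n) d) ≡ 1ℤ →
                 Γ (mat (1ℤ + τ * n) b (0ℤ + c₀ * n) d)
  Γ-of-Γ₁-form τ c₀ b d det≡1 = reduce (unimodular-translate m c₀⊥a)
    where
    a₀ : ℤ
    a₀ = 1ℤ + τ * n
    c₀⊥a-identity : ∀ τ c₀ b d n →
                    - (b * n) * c₀ + d * (1ℤ + τ * n) ≡ (1ℤ + τ * n) * d - b * (0ℤ + c₀ * n)
    c₀⊥a-identity = solve-∀
    c₀⊥a : Unimodular c₀ a₀
    c₀⊥a = - (b * n) , d , trans (c₀⊥a-identity τ c₀ b d n) det≡1
    c′≡ : ∀ τ c₀ j n → 0ℤ + c₀ * n + j * n * (1ℤ + τ * n) ≡ n * (c₀ + j * (1ℤ + τ * n))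
    c′≡ = solve-∀
    reduce : ∃[ j ] Unimodular (c₀ + j * a₀) (+ m) → Γ (mat a₀ b (0ℤ + c₀ * n) d)
    reduce (j , w⊥m) = Γ-addRow₂ Γ-subgroup (Γ-E₂₁-N j)
      (Γ-of-first-column-N·unit τ {b} {0ℤ + c₀ * n + j * n * a₀} {d + j * n * b} {c₀ + j * a₀}
        (c′≡ τ c₀ j n) w⊥m (trans (det-addRow₂ (j * n) a₀ b (0ℤ + c₀ * n) d) det≡1))

proposition3p6 : (N : ℕ) → N ≥ 1 → (Γ : Mat → Set) → IsCongruenceSubgroup Γ
    → Γ T → Γ (L N) → Γ₁ N ⊆ Γ
proposition3p6 N _ Γ (Γ-subgroup , m , m≥1 , Γ[m]⊆Γ) ΓT ΓL (mat a b c d) (det≡1 , c≡0 , a≡1 , _)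
  with mod-witness a 1ℤ a≡1 | mod-witness c 0ℤ c≡0
... | τ , refl | c₀ , refl = Γ-of-Γ₁-form τ c₀ b d det≡1
  where open Reduction N Γ-subgroup ΓT ΓL m {{>-nonZero m≥1}} Γ[m]⊆Γ
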